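{- For every $n\ge 2$, the grog numbers of the Jaco graphs satisfy $g(J_{n+1}(1)) > g(J_n(1))$.
   Context: The infinite Jaco graph $J_\infty(1)$ is the directed graph with vertex set $\{v_i : i\in\mathbb N\}$ in which, for $i<j$, the arc $(v_i,v_j)$ is present if and only if $2i - d^-(v_i)\ge j$, where $d^-(v_i)$ is the in-degree of $v_i$ (well defined recursively); there are no arcs from higher to lower index. $J_n(1)$ is the subdigraph induced by $v_1,\dots,v_n$, with vertex $v_i$ carrying label $i$. Grog algorithm: for a directed graph (orientation of a simple connected graph) with vertices labelled $v_1,\dots,v_n$, each $v_i$ has initial population $i$. A step consists of choosing a vertex $v_i$ and a number $\ell\ge 1$ of arcs $(v_i,v_j)$ still present, with $\ell$ at most the current population of $v_i$, such that each chosen head $v_j$ has current population at least $1$; the chosen arcs are removed, the population of $v_i$ decreases by $\ell$ and that of each chosen head by $1$. Steps are repeated until none is possible. A predator-prey strategy is any such sequence run to termination; its residual population is the sum of the final populations. The grog number $g(\cdot)$ of the labelled directed graph is the minimum residual population over all strategies; here $g(J_n(1))$ is taken with the labelling and orientation of $J_n(1)$ given above. -}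

module Defs where

open import Data.Nat using (ℕ; zero; suc; _+_; _*_; _∸_; _≤_; _<_; _≤ᵇ_; _<ᵇ_; _≡ᵇ_)
open import Data.Nat.Properties using (_≤?_)
open import Data.Bool using (Bool; true; false; _∧_; if_then_else_)
open import Data.List using (List; []; _∷_; _++_; [_]; length; filter; map; upTo)
open import Data.Bool.ListAction using (any)
open import Data.Nat.ListAction using (sum)
open import Data.List.Relation.Unary.All using (All)
open import Data.List.Relation.Unary.Unique.Propositional using (Unique)
open import Data.Product using (_×_; _,_; proj₁; proj₂; ∃-syntax)
open import Relation.Nullary using (¬_)
open import Relation.Binary.PropositionalEquality using (_≡_)
open import Relation.Binary.Construct.Closure.ReflexiveTransitive using (Star)

-- Given the table of (j , d⁻(v_j)) for j < i, the in-degree of v_i is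
-- the number of j < i with 2j - d⁻(v_j) ≥ i (i.e. arc (v_j , v_i) present).
newdeg : ℕ → List (ℕ × ℕ) → ℕ
newdeg i t = length (filter (λ p → i ≤? (2 * proj₁ p ∸ proj₂ p)) t)

table : ℕ → List (ℕ × ℕ)
table zero    = []
table (suc k) = table k ++ [ (suc k , newdeg (suc k) (table k)) ]

-- in-degree d⁻(v_i) in J_∞(1)  (index 0 is not a vertex; value irrelevant)
indeg : ℕ → ℕ
indeg zero    = 0
indeg (suc k) = newdeg (suc k) (table k)

jacoArc : ℕ → ℕ → Bool
jacoArc i j = (1 ≤ᵇ i) ∧ (i <ᵇ j) ∧ (j ≤ᵇ (2 * i ∸ indeg i))

jacoArcₙ : ℕ → ℕ → ℕ → Bool
jacoArcₙ n i j = jacoArc i j ∧ (j ≤ᵇ n)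

record State : Set where
  constructor ⟨_,_⟩
  field
    present : ℕ → ℕ → Bool
    pop     : ℕ → ℕ
open State public

elem : ℕ → List ℕ → Bool
elem j js = any (λ k → k ≡ᵇ j) js

apply : ℕ → List ℕ → State → State
apply i js s =
  ⟨ (λ a b → if (a ≡ᵇ i) ∧ elem b js then false else present s a b)
  , (λ k → if k ≡ᵇ i then pop s k ∸ length js
           else if elem k js then pop s k ∸ 1 else pop s k) ⟩

data Step (s : State) : State → Set where
  step : (i : ℕ) (js : List ℕ) →
         1 ≤ length js →
         length js ≤ pop s i →
         Unique js →
         All (λ j → (present s i j ≡ true) × (1 ≤ pop s j)) js →
         Step s (apply i js s)

Terminal : State → Set
Terminal s = ∀ s' → ¬ Step s s'

initial : (ℕ → ℕ → Bool) → State
initial arc = ⟨ arc , (λ i → i) ⟩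

residual : ℕ → State → ℕ
residual n s = sum (map (λ k → pop s (suc k)) (upTo n))

StrategyResidual : ℕ → (ℕ → ℕ → Bool) → ℕ → Set
StrategyResidual n arc r =
  ∃[ s ] (Star Step (initial arc) s × Terminal s × residual n s ≡ r)

IsGrogNumber : ℕ → (ℕ → ℕ → Bool) → ℕ → Set
IsGrogNumber n arc g =
  StrategyResidual n arc g × (∀ r → StrategyResidual n arc r → g ≤ r)

IsGrogJaco : ℕ → ℕ → Set
IsGrogJaco n g = IsGrogNumber n (jacoArcₙ n) g

-- Replay an optimal strategy for J_{n+1}(1) on J_n(1), simply skipping every use of an arc
-- into v_{n+1}. A predator that ate v_{n+1} keeps the unit it paid, so after the replay the
-- populations of v_1 … v_n exceed those of the original play by the number E of eaten arcs
-- into v_{n+1}, while v_{n+1} itself is left with n + 1 − E. Completing the replay greedily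
-- to a terminal position only lowers the total. Every v ≥ 2 has positive in-degree, so for
-- n ≥ 2 an arc v → v_{n+1} forces 2v > n + 1; hence 2E ≤ n, E < n + 1 − E, and the replay
-- ends with a residual population strictly below g(J_{n+1}(1)).

module Submission where

open import Defs
open import Data.Bool using (Bool; true; false; T; not; _∧_; _∨_; if_then_else_)
open import Data.Bool.Properties using (T-≡; ∧-zeroʳ) renaming (_≟_ to _≟ᵇ_)
open import Data.Empty using (⊥-elim)
open import Data.List using (List; []; _∷_; _++_; [_]; length; filter; map; upTo)
open import Data.List.Properties
  using (upTo-∷ʳ; map-++; length-++; length-filter; filter-some; filter-accept; filter-reject)
open import Data.List.Relation.Unary.All as All using (All; []; _∷_)
open import Data.List.Relation.Unary.All.Properties using (all-filter) renaming (filter⁺ to All-filter⁺)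
open import Data.List.Relation.Unary.AllPairs using ([]; _∷_)
open import Data.List.Relation.Unary.Any using (here)
open import Data.List.Relation.Unary.Any.Properties using (++⁺ʳ)
open import Data.List.Relation.Unary.Unique.Propositional using (Unique)
open import Data.List.Relation.Unary.Unique.Propositional.Properties using () renaming (filter⁺ to Unique-filter⁺)
open import Data.Nat using (ℕ; zero; suc; _+_; _*_; _∸_; _≤_; _<_; _≤ᵇ_; _≡ᵇ_; z≤n; s≤s)
open import Data.Nat.Induction using (<-wellFounded)
open import Data.Nat.ListAction using (sum)
open import Data.Nat.ListAction.Properties using (sum-++)
open import Data.Nat.Properties
open import Data.Nat.Tactic.RingSolver using (solve-∀)
open import Data.Product using (_×_; _,_; proj₁; proj₂; ∃-syntax)
open import Data.Sum using (_⊎_; inj₁; inj₂)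
open import Function using (_∘_)
open import Function.Bundles using (Equivalence)
open import Induction.WellFounded using (Acc; acc)
open import Relation.Binary.Construct.Closure.ReflexiveTransitive using (Star; ε; _◅_; _◅◅_)
open import Relation.Binary.PropositionalEquality hiding ([_])
open import Relation.Nullary using (¬_; yes; no; Dec)
open import Relation.Nullary.Decidable using (_×-dec_; ¬?)

toℕ : Bool → ℕ
toℕ b = if b then 1 else 0

T⇒≡true : ∀ {b} → T b → b ≡ true
T⇒≡true = Equivalence.to T-≡

≡true⇒T : ∀ {b} → b ≡ true → T b
≡true⇒T = Equivalence.from T-≡

¬T⇒≡false : ∀ {b} → ¬ T b → b ≡ false
¬T⇒≡false {false} _  = refl
¬T⇒≡false {true}  ¬t = ⊥-elim (¬t _)

∧-≡true : ∀ {a b} → a ∧ b ≡ true → a ≡ true × b ≡ true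
∧-≡true {true}  b≡true = refl , b≡true
∧-≡true {false} ()

≡ᵇ-refl : ∀ n → (n ≡ᵇ n) ≡ true
≡ᵇ-refl n = T⇒≡true (≡⇒≡ᵇ n n refl)

≡ᵇ-≡true⇒≡ : ∀ {m n} → (m ≡ᵇ n) ≡ true → m ≡ n
≡ᵇ-≡true⇒≡ {m} {n} = ≡ᵇ⇒≡ m n ∘ ≡true⇒T

≢⇒≡ᵇ-≡false : ∀ {m n} → m ≢ n → (m ≡ᵇ n) ≡ false
≢⇒≡ᵇ-≡false {m} {n} m≢n = ¬T⇒≡false (m≢n ∘ ≡ᵇ⇒≡ m n)

≤⇒≤ᵇ-≡true : ∀ {m n} → m ≤ n → (m ≤ᵇ n) ≡ true
≤⇒≤ᵇ-≡true = T⇒≡true ∘ ≤⇒≤ᵇ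

≰⇒≤ᵇ-≡false : ∀ {m n} → ¬ m ≤ n → (m ≤ᵇ n) ≡ false
≰⇒≤ᵇ-≡false {m} {n} m≰n = ¬T⇒≡false (m≰n ∘ ≤ᵇ⇒≤ m n)

sumTo : (ℕ → ℕ) → ℕ → ℕ
sumTo f zero    = 0
sumTo f (suc k) = sumTo f k + f (suc k)

sum-upTo : ∀ (f : ℕ → ℕ) k → sum (map (f ∘ suc) (upTo k)) ≡ sumTo f k
sum-upTo f zero    = refl
sum-upTo f (suc k) = begin
  sum (map (f ∘ suc) (upTo (suc k)))            ≡⟨ cong (sum ∘ map (f ∘ suc)) (upTo-∷ʳ k) ⟨
  sum (map (f ∘ suc) (upTo k ++ [ k ]))         ≡⟨ cong sum (map-++ (f ∘ suc) (upTo k) [ k ]) ⟩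
  sum (map (f ∘ suc) (upTo k) ++ [ f (suc k) ]) ≡⟨ sum-++ (map (f ∘ suc) (upTo k)) [ f (suc k) ] ⟩
  sum (map (f ∘ suc) (upTo k)) + (f (suc k) + 0) ≡⟨ cong₂ _+_ (sum-upTo f k) (+-identityʳ (f (suc k))) ⟩
  sumTo f k + f (suc k)                         ∎
  where open ≡-Reasoning

sumTo-cong : ∀ {f g} k → (∀ {v} → 1 ≤ v → v ≤ k → f v ≡ g v) → sumTo f k ≡ sumTo g k
sumTo-cong zero    f≡g = refl
sumTo-cong (suc k) f≡g =
  cong₂ _+_ (sumTo-cong k (λ 1≤v v≤k → f≡g 1≤v (m≤n⇒m≤1+n v≤k))) (f≡g (s≤s z≤n) ≤-refl)

sumTo-zero : ∀ {f} k → (∀ {v} → 1 ≤ v → v ≤ k → f v ≡ 0) → sumTo f k ≡ 0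
sumTo-zero k f≡0 = trans (sumTo-cong {g = λ _ → 0} k f≡0) (sumTo-const0 k)
  where
  sumTo-const0 : ∀ k → sumTo (λ _ → 0) k ≡ 0
  sumTo-const0 zero    = refl
  sumTo-const0 (suc k) = trans (+-identityʳ _) (sumTo-const0 k)

sumTo-+ : ∀ f g k → sumTo (λ v → f v + g v) k ≡ sumTo f k + sumTo g k
sumTo-+ f g zero    = refl
sumTo-+ f g (suc k) = trans (cong (_+ (f (suc k) + g (suc k))) (sumTo-+ f g k)) (swap (sumTo f k) (sumTo g k) _ _)
  where
  swap : ∀ a b c d → a + b + (c + d) ≡ a + c + (b + d)
  swap = solve-∀

sumTo-mono : ∀ {f g} k → (∀ v → f v ≤ g v) → sumTo f k ≤ sumTo g k
sumTo-mono zero    f≤g = z≤n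
sumTo-mono (suc k) f≤g = +-mono-≤ (sumTo-mono k f≤g) (f≤g (suc k))

sumTo-strict : ∀ {f g} k {i} → 1 ≤ i → i ≤ k → (∀ v → f v ≤ g v) → f i < g i → sumTo f k < sumTo g k
sumTo-strict zero () z≤n _ _
sumTo-strict (suc k) {i} 1≤i i≤1+k f≤g fi<gi with i ≟ suc k
... | yes refl = +-mono-≤-< (sumTo-mono k f≤g) fi<gi
... | no  i≢1+k = +-mono-<-≤ (sumTo-strict k 1≤i (≤-pred (≤∧≢⇒< i≤1+k i≢1+k)) f≤g fi<gi) (f≤g (suc k))

sumTo-point : ∀ k {i} b → 1 ≤ i → i ≤ k → sumTo (λ v → toℕ ((v ≡ᵇ i) ∧ b)) k ≡ toℕ b
sumTo-point zero _ () z≤n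
sumTo-point (suc k) {i} b 1≤i i≤1+k with i ≟ suc k
... | yes refl = cong₂ _+_ (sumTo-zero k off) (cong (λ x → toℕ (x ∧ b)) (≡ᵇ-refl (suc k)))
  where
  off : ∀ {v} → 1 ≤ v → v ≤ k → toℕ ((v ≡ᵇ suc k) ∧ b) ≡ 0
  off {v} _ v≤k = cong (λ x → toℕ (x ∧ b)) (≢⇒≡ᵇ-≡false (<⇒≢ (s≤s v≤k)))
... | no i≢1+k = trans (cong₂ _+_ (sumTo-point k b 1≤i (≤-pred (≤∧≢⇒< i≤1+k i≢1+k)))
                                 (cong (λ x → toℕ (x ∧ b)) (≢⇒≡ᵇ-≡false (i≢1+k ∘ sym))))
                      (+-identityʳ (toℕ b))

sumTo-sparse : ∀ {x} M k → (∀ v → x v ≡ 0 ⊎ (x v ≡ 1 × M ≤ 2 * v)) →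
               sumTo x k + sumTo x k ≤ (suc k + suc k) ∸ M
sumTo-sparse M zero    _   = z≤n
sumTo-sparse {x} M (suc k) x01 with x01 (suc k)
... | inj₁ x≡0 rewrite x≡0 | +-identityʳ (sumTo x k) =
  ≤-trans (sumTo-sparse M k x01) (∸-monoˡ-≤ M (+-mono-≤ (n≤1+n (suc k)) (n≤1+n (suc k))))
... | inj₂ (x≡1 , M≤2v) rewrite x≡1 = begin
  sumTo x k + 1 + (sumTo x k + 1)      ≡⟨ two-more (sumTo x k) ⟩
  2 + (sumTo x k + sumTo x k)          ≤⟨ +-monoʳ-≤ 2 (sumTo-sparse M k x01) ⟩
  2 + ((suc k + suc k) ∸ M)            ≡⟨ +-∸-assoc 2 M≤2+2k ⟨
  (2 + (suc k + suc k)) ∸ M            ≡⟨ cong (λ a → suc a ∸ M) (+-suc (suc k) (suc k)) ⟨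
  (suc (suc k) + suc (suc k)) ∸ M      ∎
  where
  open ≤-Reasoning
  two-more : ∀ a → a + 1 + (a + 1) ≡ 2 + (a + a)
  two-more = solve-∀
  M≤2+2k : M ≤ suc k + suc k
  M≤2+2k = ≤-trans M≤2v (≤-reflexive (cong (suc k +_) (+-identityʳ (suc k))))

+-∸-shift : ∀ p e l c → l + c ≤ p → (p + e) ∸ l ≡ (p ∸ (l + c)) + (e + c)
+-∸-shift p e l c l+c≤p = begin
  (p + e) ∸ l               ≡⟨ cong (λ x → (x + e) ∸ l) (m∸n+n≡m l+c≤p) ⟨
  (q + (l + c) + e) ∸ l     ≡⟨ cong (_∸ l) (rearrange q l c e) ⟩
  (l + (q + (e + c))) ∸ l   ≡⟨ m+n∸m≡n l _ ⟩
  q + (e + c)               ∎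
  where
  open ≡-Reasoning
  q = p ∸ (l + c)
  rearrange : ∀ q l c e → q + (l + c) + e ≡ l + (q + (e + c))
  rearrange = solve-∀

-- The Jaco graph

length-table : ∀ k → length (table k) ≡ k
length-table zero    = refl
length-table (suc k) = trans (length-++ (table k)) (trans (cong (_+ 1) (length-table k)) (+-comm k 1))

indeg-≤ : ∀ k → indeg (suc k) ≤ k
indeg-≤ k = ≤-trans (length-filter _ (table k)) (≤-reflexive (length-table k))

indeg-positive : ∀ m → 1 ≤ indeg (suc (suc m))
indeg-positive m = filter-some (λ p → suc (suc m) ≤? (2 * proj₁ p ∸ proj₂ p)) (++⁺ʳ (table m) (here arc))
  where
  arc : suc (suc m) ≤ 2 * suc m ∸ indeg (suc m)
  arc = begin
    suc (suc m)                   ≡⟨ m+n∸m≡n m (suc (suc m)) ⟨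
    (m + suc (suc m)) ∸ m         ≡⟨ cong (_∸ m) (double m) ⟩
    2 * suc m ∸ m                 ≤⟨ ∸-monoʳ-≤ (2 * suc m) (indeg-≤ m) ⟩
    2 * suc m ∸ indeg (suc m)     ∎
    where
    open ≤-Reasoning
    double : ∀ m → m + suc (suc m) ≡ 2 * suc m
    double = solve-∀

jacoArc-bounds : ∀ {i j} → jacoArc i j ≡ true → 1 ≤ i × i < j × j ≤ 2 * i ∸ indeg i
jacoArc-bounds {i} {j} arc =
  let p₁ , p₂₃ = ∧-≡true arc
      p₂ , p₃  = ∧-≡true p₂₃
  in ≤ᵇ⇒≤ 1 i (≡true⇒T p₁) , <ᵇ⇒< i j (≡true⇒T p₂) , ≤ᵇ⇒≤ j _ (≡true⇒T p₃)

jacoArcₙ-bounds : ∀ {n i j} → jacoArcₙ n i j ≡ true → 1 ≤ i × i < j × j ≤ n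
jacoArcₙ-bounds {n} {i} {j} arc =
  let arcᵢⱼ , j≤ᵇn = ∧-≡true arc
      1≤i , i<j , _ = jacoArc-bounds arcᵢⱼ
  in 1≤i , i<j , ≤ᵇ⇒≤ j n (≡true⇒T j≤ᵇn)

jacoArc-head< : ∀ {v w} → jacoArc v w ≡ true → 3 ≤ w → w < 2 * v
jacoArc-head< {zero}        ()
jacoArc-head< {suc zero}    {w} arc 3≤w = ⊥-elim (<⇒≱ 3≤w (proj₂ (proj₂ (jacoArc-bounds {1} {w} arc))))
jacoArc-head< {suc (suc m)} {w} arc _   =
  ≤-<-trans (proj₂ (proj₂ (jacoArc-bounds {suc (suc m)} {w} arc))) (∸-monoʳ-< (indeg-positive m) indeg≤2v)
  where
  indeg≤2v : indeg (suc (suc m)) ≤ 2 * suc (suc m)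
  indeg≤2v = ≤-trans (indeg-≤ (suc m)) (≤-trans (n≤1+n (suc m)) (m≤n*m (suc (suc m)) 2))

-- Moves of the grog algorithm

Prey : State → ℕ → ℕ → Set
Prey s i j = present s i j ≡ true × 1 ≤ pop s j

loss : ℕ → List ℕ → ℕ → ℕ
loss i js v = if v ≡ᵇ i then length js else toℕ (elem v js)

pop-apply : ∀ i js s v → pop (apply i js s) v ≡ pop s v ∸ loss i js v
pop-apply i js s v with v ≡ᵇ i
... | true = refl
... | false with elem v js
...   | true  = refl
...   | false = refl

pop-apply-[] : ∀ i s v → pop (apply i [] s) v ≡ pop s v
pop-apply-[] i s v with v ≡ᵇ i
... | true  = refl
... | false = refl

loss-self : ∀ i js → loss i js i ≡ length js
loss-self i js = cong (λ b → if b then length js else toℕ (elem i js)) (≡ᵇ-refl i)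

loss-other : ∀ {i v} js → v ≢ i → loss i js v ≡ toℕ (elem v js)
loss-other {i} {v} js v≢i = cong (λ b → if b then length js else toℕ (elem v js)) (≢⇒≡ᵇ-≡false v≢i)

All-elem : ∀ {P : ℕ → Set} {b} js → All P js → elem b js ≡ true → P b
All-elem {P} {b} (j ∷ js) (pj ∷ pjs) b∈js with j ≡ᵇ b in j≡ᵇb
... | true  = subst P (≡ᵇ-≡true⇒≡ j≡ᵇb) pj
... | false = All-elem js pjs b∈js

loss-≤-pop : ∀ {i js s} v → length js ≤ pop s i → All (Prey s i) js → loss i js v ≤ pop s v
loss-≤-pop {i} {js} {s} v ℓ≤pop prey with v ≡ᵇ i in v≡ᵇi
... | true = subst (λ x → length js ≤ pop s x) (sym (≡ᵇ-≡true⇒≡ v≡ᵇi)) ℓ≤pop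
... | false with elem v js in v∈js
...   | true  = proj₂ (All-elem js prey v∈js)
...   | false = z≤n

removed-was-present : ∀ {i js s a b} → (a ≡ᵇ i) ∧ elem b js ≡ true → All (Prey s i) js → present s a b ≡ true
removed-was-present {i} {js} {s} {a} {b} removed prey =
  let a≡ᵇi , b∈js = ∧-≡true removed
  in subst (λ a → present s a b ≡ true) (sym (≡ᵇ-≡true⇒≡ a≡ᵇi)) (proj₁ (All-elem js prey b∈js))

ArcsIn : (ℕ → ℕ → Bool) → State → Set
ArcsIn arc s = ∀ {a b} → present s a b ≡ true → arc a b ≡ true

ArcsIn-apply : ∀ {arc} s i js → ArcsIn arc s → ArcsIn arc (apply i js s)
ArcsIn-apply s i js inside {a} {b} p with (a ≡ᵇ i) ∧ elem b js
... | false = inside p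
ArcsIn-apply s i js inside {a} {b} () | true

ArcsIn-star : ∀ {arc s u} → Star Step s u → ArcsIn arc s → ArcsIn arc u
ArcsIn-star ε                              inside = inside
ArcsIn-star {s = s} (step i js _ _ _ _ ◅ play) inside = ArcsIn-star play (ArcsIn-apply s i js inside)

sumTo-pop-apply-< : ∀ {n i js} s → 1 ≤ i → i ≤ n → 1 ≤ length js → length js ≤ pop s i →
                   sumTo (pop (apply i js s)) n < sumTo (pop s) n
sumTo-pop-apply-< {n} {i} {js} s 1≤i i≤n 1≤ℓ ℓ≤pop = sumTo-strict n 1≤i i≤n pop-decreases pop-i-decreases
  where
  pop-decreases : ∀ v → pop (apply i js s) v ≤ pop s v
  pop-decreases v = ≤-trans (≤-reflexive (pop-apply i js s v)) (m∸n≤m (pop s v) (loss i js v))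
  pop-i-decreases : pop (apply i js s) i < pop s i
  pop-i-decreases = begin-strict
    pop (apply i js s) i        ≡⟨ pop-apply i js s i ⟩
    pop s i ∸ loss i js i       ≡⟨ cong (pop s i ∸_) (loss-self i js) ⟩
    pop s i ∸ length js         <⟨ ∸-monoʳ-< 1≤ℓ ℓ≤pop ⟩
    pop s i                     ∎
    where open ≤-Reasoning

OnVertices : ℕ → (ℕ → ℕ → Bool) → Set
OnVertices n arc = ∀ {a b} → arc a b ≡ true → (1 ≤ a × a ≤ n) × (1 ≤ b × b ≤ n)

jacoArcₙ-onVertices : ∀ n → OnVertices n (jacoArcₙ n)
jacoArcₙ-onVertices n arc =
  let 1≤i , i<j , j≤n = jacoArcₙ-bounds arc
  in (1≤i , <⇒≤ (<-≤-trans i<j j≤n)) , (≤-trans 1≤i (<⇒≤ i<j) , j≤n)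

module _ {n arc} (on-vertices : OnVertices n arc) where

  Enabled : State → ℕ → ℕ → Set
  Enabled s i j = Prey s i j × 1 ≤ pop s i

  terminal-extension : ∀ s → ArcsIn arc s →
                       ∃[ u ] (Star Step s u × Terminal u × sumTo (pop u) n ≤ sumTo (pop s) n)
  terminal-extension s inside = go s inside (<-wellFounded (sumTo (pop s) n))
    where
    enabled? : ∀ s i j → Dec (Enabled s i j)
    enabled? s i j = ((present s i j ≟ᵇ true) ×-dec (1 ≤? pop s j)) ×-dec (1 ≤? pop s i)

    go : ∀ s → ArcsIn arc s → Acc _<_ (sumTo (pop s) n) →
         ∃[ u ] (Star Step s u × Terminal u × sumTo (pop u) n ≤ sumTo (pop s) n)
    go s inside (acc smaller)
      with anyUpTo? (λ i → anyUpTo? (enabled? s i) (suc n)) (suc n)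
    ... | yes (i , _ , j , _ , prey , 1≤pop) =
      let (1≤i , i≤n) , _ = on-vertices (inside (proj₁ prey))
          fewer = sumTo-pop-apply-< {js = [ j ]} s 1≤i i≤n ≤-refl 1≤pop
          u , play , terminal , u≤ = go (apply i [ j ] s) (ArcsIn-apply s i [ j ] inside) (smaller fewer)
      in u , step i [ j ] ≤-refl 1≤pop ([] ∷ []) (prey ∷ []) ◅ play , terminal , ≤-trans u≤ (<⇒≤ fewer)
    ... | no nothing-enabled = s , ε , terminal , ≤-refl
      where
      terminal : Terminal s
      terminal _ (step i (j ∷ _) 1≤ℓ ℓ≤pop _ (prey ∷ _)) =
        let (_ , i≤n) , (_ , j≤n) = on-vertices (inside (proj₁ prey))
        in nothing-enabled (i , s≤s i≤n , j , s≤s j≤n , prey , ≤-trans 1≤ℓ ℓ≤pop)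

-- Replaying a strategy on J_{n+1}(1) inside J_n(1)

module TopVertexDeletion (n : ℕ) where

  N : ℕ
  N = suc n

  removeTop : List ℕ → List ℕ
  removeTop = filter (λ j → ¬? (j ≟ N))

  removeTop-top : ∀ js → removeTop (N ∷ js) ≡ removeTop js
  removeTop-top js = filter-reject (λ j → ¬? (j ≟ N)) (λ N≢N → N≢N refl)

  removeTop-other : ∀ {j} js → j ≢ N → removeTop (j ∷ js) ≡ j ∷ removeTop js
  removeTop-other js j≢N = filter-accept (λ j → ¬? (j ≟ N)) j≢N

  elem-removeTop : ∀ {b} js → b ≢ N → elem b (removeTop js) ≡ elem b js
  elem-removeTop []       _   = refl
  elem-removeTop {b} (j ∷ js) b≢N with j ≟ N
  ... | yes refl = begin
    elem b (removeTop (N ∷ js))   ≡⟨ cong (elem b) (removeTop-top js) ⟩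
    elem b (removeTop js)         ≡⟨ elem-removeTop js b≢N ⟩
    elem b js                     ≡⟨ cong (_∨ elem b js) (≢⇒≡ᵇ-≡false (b≢N ∘ sym)) ⟨
    elem b (N ∷ js)               ∎
    where open ≡-Reasoning
  ... | no  j≢N = trans (cong (elem b) (removeTop-other js j≢N)) (cong ((j ≡ᵇ b) ∨_) (elem-removeTop js b≢N))

  elem-∉ : ∀ {b} js → All (b ≢_) js → elem b js ≡ false
  elem-∉ []       []             = refl
  elem-∉ (j ∷ js) (b≢j ∷ b∉js) = cong₂ _∨_ (≢⇒≡ᵇ-≡false (b≢j ∘ sym)) (elem-∉ js b∉js)

  length-removeTop : ∀ js → Unique js → length js ≡ length (removeTop js) + toℕ (elem N js)
  length-removeTop []       []             = refl
  length-removeTop (j ∷ js) (j∉js ∷ uniq) with j ≟ N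
  ... | yes refl rewrite removeTop-top js | ≡ᵇ-refl N = begin
    suc (length js)                                ≡⟨ cong suc (length-removeTop js uniq) ⟩
    suc (length (removeTop js) + toℕ (elem N js))  ≡⟨ cong (λ b → suc (length (removeTop js) + toℕ b))
                                                           (elem-∉ js j∉js) ⟩
    suc (length (removeTop js) + 0)                ≡⟨ cong suc (+-identityʳ _) ⟩
    suc (length (removeTop js))                    ≡⟨ +-comm 1 _ ⟩
    length (removeTop js) + 1                      ∎
    where open ≡-Reasoning
  ... | no  j≢N rewrite removeTop-other js j≢N | ≢⇒≡ᵇ-≡false j≢N = cong suc (length-removeTop js uniq)

  eaten : State → ℕ → ℕ
  eaten t v = toℕ (jacoArc v N ∧ not (present t v N))

  eaten-present : ∀ {t v} → present t v N ≡ true → eaten t v ≡ 0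
  eaten-present {t} {v} present = trans (cong (λ p → toℕ (jacoArc v N ∧ not p)) present) (cong toℕ (∧-zeroʳ _))

  eaten-cases : ∀ t v → eaten t v ≡ 0 ⊎ (eaten t v ≡ 1 × jacoArc v N ≡ true)
  eaten-cases t v with jacoArc v N | present t v N
  ... | false | _     = inj₁ refl
  ... | true  | true  = inj₁ refl
  ... | true  | false = inj₂ (refl , refl)

  eaten-initial : ∀ v → eaten (initial (jacoArcₙ N)) v ≡ 0
  eaten-initial v rewrite ≤⇒≤ᵇ-≡true (≤-refl {N}) with jacoArc v N
  ... | true  = refl
  ... | false = refl

  eaten-apply : ∀ {t i js} v → ArcsIn (jacoArcₙ N) t → All (Prey t i) js →
                eaten (apply i js t) v ≡ eaten t v + toℕ ((v ≡ᵇ i) ∧ elem N js)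
  eaten-apply {t} {i} {js} v arcs prey with (v ≡ᵇ i) ∧ elem N js in removed
  ... | false = sym (+-identityʳ (eaten t v))
  ... | true  =
    let was-present = removed-was-present {i} {js} {t} {v} removed prey
    in trans (cong (λ a → toℕ (a ∧ true)) (proj₁ (∧-≡true (arcs was-present))))
             (sym (cong (_+ 1) (eaten-present {t} {v} was-present)))

  loss-removeTop : ∀ {i js} v → v ≢ N → Unique js →
                   loss i js v ≡ loss i (removeTop js) v + toℕ ((v ≡ᵇ i) ∧ elem N js)
  loss-removeTop {i} {js} v v≢N uniq with v ≡ᵇ i
  ... | true  = length-removeTop js uniq
  ... | false = trans (cong toℕ (sym (elem-removeTop js v≢N))) (sym (+-identityʳ _))

  -- s replays t inside J_n(1), skipping every use of an arc into v_N: a predator that ate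
  -- v_N keeps the unit it paid for it, and v_N has lost one unit per eaten arc.
  record Shadow (s t : State) : Set where
    field
      present-≡ : ∀ a {b} → b ≢ N → present s a b ≡ present t a b
      pop-≡     : ∀ {v} → v ≢ N → pop s v ≡ pop t v + eaten t v
      pop-top   : pop t N + sumTo (eaten t) n ≡ N
      arcs      : ArcsIn (jacoArcₙ N) t

  shadow-initial : Shadow (initial (jacoArcₙ n)) (initial (jacoArcₙ N))
  shadow-initial = record
    { present-≡ = λ a {b} b≢N → cong (jacoArc a b ∧_) (≤ᵇ-below-top b≢N)
    ; pop-≡     = λ {v} _ → sym (trans (cong (v +_) (eaten-initial v)) (+-identityʳ v))
    ; pop-top   = trans (cong (N +_) (sumTo-zero n (λ {v} _ _ → eaten-initial v))) (+-identityʳ N)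
    ; arcs      = λ arc → arc
    }
    where
    ≤ᵇ-below-top : ∀ {b} → b ≢ N → (b ≤ᵇ n) ≡ (b ≤ᵇ N)
    ≤ᵇ-below-top {b} b≢N with b ≤? n
    ... | yes b≤n = trans (≤⇒≤ᵇ-≡true b≤n) (sym (≤⇒≤ᵇ-≡true (m≤n⇒m≤1+n b≤n)))
    ... | no  b≰n =
      trans (≰⇒≤ᵇ-≡false b≰n) (sym (≰⇒≤ᵇ-≡false (λ b≤N → b≢N (≤-antisym b≤N (≰⇒> b≰n)))))

  shadow-apply-[] : ∀ {s t} i → Shadow (apply i [] s) t → Shadow s t
  shadow-apply-[] {s} i sh = record
    { present-≡ = λ a {b} b≢N → trans (cong (λ c → if c then false else present s a b) (sym (∧-zeroʳ (a ≡ᵇ i))))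
                                       (present-≡ a b≢N)
    ; pop-≡     = λ {v} v≢N → trans (sym (pop-apply-[] i s v)) (pop-≡ v≢N)
    ; pop-top   = pop-top
    ; arcs      = arcs
    }
    where open Shadow sh

  module _ {s t i js} (sh : Shadow s t) (1≤i : 1 ≤ i) (i≤n : i ≤ n) (ℓ≤pop : length js ≤ pop t i)
           (uniq : Unique js) (prey : All (Prey t i) js) where
    open Shadow sh

    length-removeTop-≤-pop : length (removeTop js) ≤ pop s i
    length-removeTop-≤-pop = begin
      length (removeTop js)  ≤⟨ length-filter _ js ⟩
      length js              ≤⟨ ℓ≤pop ⟩
      pop t i                ≤⟨ m≤m+n (pop t i) (eaten t i) ⟩
      pop t i + eaten t i    ≡⟨ pop-≡ (<⇒≢ (s≤s i≤n)) ⟨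
      pop s i                ∎
      where open ≤-Reasoning

    prey-removeTop : All (Prey s i) (removeTop js)
    prey-removeTop = All.zipWith shadow-prey (All-filter⁺ _ prey , all-filter _ js)
      where
      shadow-prey : ∀ {k} → Prey t i k × k ≢ N → Prey s i k
      shadow-prey ((i→k , 1≤pop) , k≢N) =
        trans (present-≡ i k≢N) i→k , ≤-trans 1≤pop (≤-trans (m≤m+n _ _) (≤-reflexive (sym (pop-≡ k≢N))))

    shadow-pop-≡ : ∀ {v} → v ≢ N →
                   pop (apply i (removeTop js) s) v ≡ pop (apply i js t) v + eaten (apply i js t) v
    shadow-pop-≡ {v} v≢N = begin
      pop (apply i ks s) v                       ≡⟨ pop-apply i ks s v ⟩
      pop s v ∸ loss i ks v                      ≡⟨ cong (_∸ loss i ks v) (pop-≡ v≢N) ⟩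
      (pop t v + eaten t v) ∸ loss i ks v        ≡⟨ +-∸-shift (pop t v) (eaten t v) (loss i ks v) _ loss≤pop ⟩
      (pop t v ∸ (loss i ks v + removed)) + (eaten t v + removed)
        ≡⟨ cong₂ _+_ (cong (pop t v ∸_) (loss-removeTop v v≢N uniq)) (eaten-apply {t} v arcs prey) ⟨
      (pop t v ∸ loss i js v) + eaten (apply i js t) v ≡⟨ cong (_+ eaten (apply i js t) v) (pop-apply i js t v) ⟨
      pop (apply i js t) v + eaten (apply i js t) v ∎
      where
      open ≡-Reasoning
      ks = removeTop js
      removed = toℕ ((v ≡ᵇ i) ∧ elem N js)
      loss≤pop : loss i ks v + removed ≤ pop t v
      loss≤pop = subst (_≤ pop t v) (loss-removeTop v v≢N uniq) (loss-≤-pop {s = t} v ℓ≤pop prey)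

    shadow-pop-top : pop (apply i js t) N + sumTo (eaten (apply i js t)) n ≡ N
    shadow-pop-top = begin
      pop (apply i js t) N + sumTo (eaten (apply i js t)) n  ≡⟨ cong₂ _+_ (pop-apply i js t N) eaten-total ⟩
      (pop t N ∸ loss i js N) + (sumTo (eaten t) n + loss i js N)
        ≡⟨ +-∸-shift (pop t N) (sumTo (eaten t) n) 0 (loss i js N) (loss-≤-pop {s = t} N ℓ≤pop prey) ⟨
      pop t N + sumTo (eaten t) n                            ≡⟨ pop-top ⟩
      N                                                      ∎
      where
      open ≡-Reasoning
      eaten-total : sumTo (eaten (apply i js t)) n ≡ sumTo (eaten t) n + loss i js N
      eaten-total = begin
        sumTo (eaten (apply i js t)) n
          ≡⟨ sumTo-cong n (λ {v} _ _ → eaten-apply {t} v arcs prey) ⟩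
        sumTo (λ v → eaten t v + toℕ ((v ≡ᵇ i) ∧ elem N js)) n
          ≡⟨ sumTo-+ (eaten t) _ n ⟩
        sumTo (eaten t) n + sumTo (λ v → toℕ ((v ≡ᵇ i) ∧ elem N js)) n
          ≡⟨ cong (sumTo (eaten t) n +_) (sumTo-point n (elem N js) 1≤i i≤n) ⟩
        sumTo (eaten t) n + toℕ (elem N js)
          ≡⟨ cong (sumTo (eaten t) n +_) (loss-other js (<⇒≢ (s≤s i≤n) ∘ sym)) ⟨
        sumTo (eaten t) n + loss i js N ∎

    shadow-apply : Shadow (apply i (removeTop js) s) (apply i js t)
    shadow-apply = record
      { present-≡ = λ a {b} b≢N → cong₂ (λ c x → if (a ≡ᵇ i) ∧ c then false else x)
                                         (elem-removeTop js b≢N) (present-≡ a b≢N)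
      ; pop-≡     = shadow-pop-≡
      ; pop-top   = shadow-pop-top
      ; arcs      = ArcsIn-apply t i js arcs
      }

  shadow-step : ∀ {s t t′} → Shadow s t → Step t t′ → ∃[ s′ ] (Star Step s s′ × Shadow s′ t′)
  shadow-step {s} {t} sh (step i js@(j ∷ _) _ ℓ≤pop uniq prey@((i→j , _) ∷ _)) =
    let 1≤i , i<j , j≤N = jacoArcₙ-bounds {N} {i} {j} (Shadow.arcs sh i→j)
        i≤n = ≤-pred (<-≤-trans i<j j≤N)
    in move-or-stay (removeTop js) (length-removeTop-≤-pop sh 1≤i i≤n ℓ≤pop uniq prey)
                    (Unique-filter⁺ (λ k → ¬? (k ≟ N)) uniq) (prey-removeTop sh 1≤i i≤n ℓ≤pop uniq prey)
                    (shadow-apply sh 1≤i i≤n ℓ≤pop uniq prey)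
    where
    move-or-stay : ∀ ks → length ks ≤ pop s i → Unique ks → All (Prey s i) ks →
                   Shadow (apply i ks s) (apply i js t) → ∃[ s′ ] (Star Step s s′ × Shadow s′ (apply i js t))
    move-or-stay []           _      _     _     sh′ = s , ε , shadow-apply-[] i sh′
    move-or-stay ks@(_ ∷ _) ks≤pop uniqₖ preyₖ sh′ =
      apply i ks s , step i ks (s≤s z≤n) ks≤pop uniqₖ preyₖ ◅ ε , sh′

  shadow-play : ∀ {s t t′} → Shadow s t → Star Step t t′ → ∃[ s′ ] (Star Step s s′ × Shadow s′ t′)
  shadow-play sh ε = _ , ε , sh
  shadow-play sh (st ◅ play) =
    let s₁ , play₁ , sh₁ = shadow-step sh st
        s₂ , play₂ , sh₂ = shadow-play sh₁ play
    in s₂ , play₁ ◅◅ play₂ , sh₂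

  eaten-sum-bound : 2 ≤ n → ∀ t → sumTo (eaten t) n + sumTo (eaten t) n ≤ n
  eaten-sum-bound 2≤n t =
    ≤-trans (sumTo-sparse (suc N) n eaten-sparse) (≤-reflexive (m+n∸n≡m n (suc n)))
    where
    eaten-sparse : ∀ v → eaten t v ≡ 0 ⊎ (eaten t v ≡ 1 × suc N ≤ 2 * v)
    eaten-sparse v with eaten-cases t v
    ... | inj₁ none          = inj₁ none
    ... | inj₂ (one , v→N) = inj₂ (one , jacoArc-head< {v} {N} v→N (s≤s 2≤n))

  shadow-pop-< : 2 ≤ n → ∀ {s t} → Shadow s t → sumTo (pop s) n < residual N t
  shadow-pop-< 2≤n {s} {t} sh = begin-strict
    sumTo (pop s) n                        ≡⟨ sumTo-cong n (λ _ v≤n → pop-≡ (<⇒≢ (s≤s v≤n))) ⟩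
    sumTo (λ v → pop t v + eaten t v) n    ≡⟨ sumTo-+ (pop t) (eaten t) n ⟩
    sumTo (pop t) n + E                    <⟨ +-monoʳ-< (sumTo (pop t) n) E<pop-top ⟩
    sumTo (pop t) n + pop t N              ≡⟨ sum-upTo (pop t) N ⟨
    residual N t                           ∎
    where
    open Shadow sh
    open ≤-Reasoning
    E = sumTo (eaten t) n
    E<pop-top : E < pop t N
    E<pop-top = +-cancelʳ-< E E (pop t N) (subst (E + E <_) (sym pop-top) (s≤s (eaten-sum-bound 2≤n t)))

corollary2p11 : (n : ℕ) → 2 ≤ n → (g g' : ℕ) →
                IsGrogJaco n g → IsGrogJaco (suc n) g' → g < g'
corollary2p11 n 2≤n g g' (_ , g-minimal) ((t , play , _ , t-residual) , _) =
  let s , s-play , s-shadows-t = shadow-play shadow-initial play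
      u , u-play , u-terminal , u≤s =
        terminal-extension (jacoArcₙ-onVertices n) s (ArcsIn-star s-play (λ arc → arc))
  in begin-strict
    g                   ≤⟨ g-minimal (residual n u) (u , s-play ◅◅ u-play , u-terminal , refl) ⟩
    residual n u        ≡⟨ sum-upTo (pop u) n ⟩
    sumTo (pop u) n     ≤⟨ u≤s ⟩
    sumTo (pop s) n     <⟨ shadow-pop-< 2≤n s-shadows-t ⟩
    residual (suc n) t  ≡⟨ t-residual ⟩
    g'                  ∎
  where
  open TopVertexDeletion n
  open ≤-Reasoning
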